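{- Let $g(x),f(x)$ be formal power series with integer coefficients and $g(0)=f(0)=1$, let $a_{n,k}=[x^n]g(x)(xf(x))^k$, and let $\phi(x)$ be the reversion of $x/f(x)$. Let $c(A;1)$ be the lower-triangular matrix with $(n,k)$ entry $a_{2n,n+k}$ and $c(A;2)$ the lower-triangular matrix with $(n,k)$ entry $a_{2n+1,n+k+1}$. Then $$c(A;1)^{ -1}\cdot c(A;2)\cdot c(A;1)^{ -1}=\left(\phi'(x)\frac{g(\phi(x))}{f(\phi(x))^2},\ \phi(x)f(\phi(x))\right)^{ -1}.$$
   Context: A Riordan array $(d(x),h(x))$, for formal power series $d,h$ with $d(0)\neq 0$, $h(0)=0$, $h'(0)\neq 0$, is the infinite lower-triangular matrix whose $(n,k)$ entry is $[x^n]d(x)h(x)^k$. Riordan arrays form a group under matrix multiplication, with $(d,h)\cdot(u,w)=(d(x)u(h(x)),w(h(x)))$ and $(d,h)^{ -1}=(1/d(\bar h),\bar h)$, where $\bar h$ is the reversion of $h$: the power series $u$ with $u(0)=0$ and $h(u(x))=x$. $\phi'$ denotes the derivative of $\phi$. -}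

module Defs where

open import Data.Nat using (ℕ; zero; suc; _∸_) renaming (_+_ to _+ℕ_; _*_ to _*ℕ_; _<_ to _<ℕ_)
open import Data.Integer using (ℤ; +_; _+_; _*_; -_; _-_)
open import Relation.Binary.PropositionalEquality using (_≡_)

Series : Set
Series = ℕ → ℤ

Matrix : Set
Matrix = ℕ → ℕ → ℤ

sumTo : ℕ → (ℕ → ℤ) → ℤ
sumTo zero    t = t zero
sumTo (suc n) t = sumTo n t + t (suc n)

oneS : Series
oneS zero    = + 1
oneS (suc _) = + 0

X : Series
X (suc zero) = + 1
X _          = + 0

_⊛_ : Series → Series → Series
(a ⊛ b) n = sumTo n (λ k → a k * b (n ∸ k))

infixl 7 _⊛_

powS : Series → ℕ → Series
powS a zero    = oneS
powS a (suc k) = a ⊛ powS a k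

-- composition a(b(x)); meaningful (and used only) when b 0 = 0,
-- in which case [x^n] a(b(x)) = Σ_{k ≤ n} a_k [x^n] b(x)^k
_∘ₛ_ : Series → Series → Series
(a ∘ₛ b) n = sumTo n (λ k → a k * powS b k n)

deriv : Series → Series
deriv a n = + (suc n) * a (suc n)

oneMinus : Series → Series
oneMinus a zero    = + 1 - a zero
oneMinus a (suc n) = - a (suc n)

-- multiplicative inverse 1/a, for series with a 0 = 1:
-- 1/a = Σ_k (1 - a)^k, and [x^n] only involves k ≤ n.
invS : Series → Series
invS a n = sumTo n (λ k → powS (oneMinus a) k n)

riordan : Series → Series → Matrix
riordan d h n k = (d ⊛ powS h k) n

δ : Matrix
δ zero    zero    = + 1
δ zero    (suc _) = + 0
δ (suc _) zero    = + 0
δ (suc n) (suc k) = δ n k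

LowerTri : Matrix → Set
LowerTri M = ∀ n k → n <ℕ k → M n k ≡ + 0

-- product of matrices whose left factor is lower triangular:
-- (A · B) n k = Σ_{j ≤ n} A n j * B j k
_·_ : Matrix → Matrix → Matrix
(A · B) n k = sumTo n (λ j → A n j * B j k)

infixl 7 _·_

aEntry : Series → Series → ℕ → ℕ → ℤ
aEntry g f = riordan g (X ⊛ f)

cA1 : Series → Series → Matrix
cA1 g f n k = aEntry g f (n +ℕ n) (n +ℕ k)

cA2 : Series → Series → Matrix
cA2 g f n k = aEntry g f (suc (n +ℕ n)) (suc (n +ℕ k))

IsReversionOf : Series → Series → Set
IsReversionOf φ h = (φ 0 ≡ + 0) × (∀ n → (h ∘ₛ φ) n ≡ X n)
  where open import Data.Product using (_×_)

dRHS : Series → Series → Series → Series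
dRHS g f φ = deriv φ ⊛ (g ∘ₛ φ) ⊛ invS ((f ∘ₛ φ) ⊛ (f ∘ₛ φ))

hRHS : Series → Series → Series
hRHS f φ = φ ⊛ (f ∘ₛ φ)

-- Write F = f(φ), G = g(φ) and c = Σ [xⁿ] f(x)ⁿ · xⁿ.  Since x/f is reverted by φ we have φ = x F,
-- and Lagrange inversion in the form [xⁿ] H fⁿ = [xⁿ] c · H(φ) reads off the columns of the two
-- matrices: c(A;1) = (c G, x F²) and c(A;2) = (F c G, x F²) = T · c(A;1), where T is the Toeplitz
-- matrix of F.  Differentiating φ = x F gives φ' = F c, so c(A;1) = T · R with R the Riordan array
-- (φ' G / F², x F²) of the statement.  Hence, writing M = c(A;1)⁻¹,
-- M · c(A;2) · M = M · T · c(A;1) · M = M · T = R⁻¹.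

module Submission where

open import Defs
open import Algebra.Bundles using (CommutativeSemigroup)
open import Data.Integer using (ℤ; +_; _+_; _*_; -_)
import Data.Integer.Properties as ZP
open import Algebra.Properties.AbelianGroup ZP.+-0-abelianGroup using (∙-cancelˡ; ∙-cancelʳ)
open import Data.Integer.Tactic.RingSolver using (solve-∀)
open import Algebra.Properties.CommutativeSemigroup ZP.*-commutativeSemigroup
  using () renaming (x∙yz≈y∙xz to *-leftComm)
open import Algebra.Properties.CommutativeSemigroup ZP.+-commutativeSemigroup
  using () renaming (interchange to +-interchange)
open import Data.Nat as ℕ using (ℕ; zero; suc; _∸_; z≤n; s≤s)
  renaming (_+_ to _+ℕ_; _≤_ to _≤ℕ_; _<_ to _<ℕ_)
import Data.Nat.Properties as NP
open import Data.Nat.Induction using (<-rec)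
import Data.Nat.Tactic.RingSolver as ℕSolver
open import Data.Product using (_×_; _,_; proj₁; proj₂)
open import Data.Empty using (⊥-elim)
open import Function using (_∘_)
open import Level using (0ℓ)
open import Relation.Binary.Bundles using (Setoid)
open import Relation.Binary.Definitions using (tri<; tri≈; tri>)
open import Relation.Binary.PropositionalEquality
import Relation.Binary.Reasoning.Setoid as SetoidReasoning
open import Relation.Nullary using (yes; no)

-- Finite sums

sumTo-cong : ∀ n {f g : ℕ → ℤ} → (∀ k → k ≤ℕ n → f k ≡ g k) → sumTo n f ≡ sumTo n g
sumTo-cong zero    f≡g = f≡g zero z≤n
sumTo-cong (suc n) f≡g =
  cong₂ _+_ (sumTo-cong n (λ k k≤n → f≡g k (NP.m≤n⇒m≤1+n k≤n))) (f≡g (suc n) NP.≤-refl)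

sumTo-shift : ∀ n (f : ℕ → ℤ) → sumTo (suc n) f ≡ f 0 + sumTo n (f ∘ suc)
sumTo-shift zero    f = refl
sumTo-shift (suc n) f = begin
  sumTo (suc n) f + f (suc (suc n))                 ≡⟨ cong (_+ f (suc (suc n))) (sumTo-shift n f) ⟩
  (f 0 + sumTo n (f ∘ suc)) + f (suc (suc n))       ≡⟨ ZP.+-assoc (f 0) _ _ ⟩
  f 0 + sumTo (suc n) (f ∘ suc)                     ∎
  where open ≡-Reasoning

sumTo-+ : ∀ n (f g : ℕ → ℤ) → sumTo n (λ k → f k + g k) ≡ sumTo n f + sumTo n g
sumTo-+ zero    f g = refl
sumTo-+ (suc n) f g = trans (cong (_+ (f (suc n) + g (suc n))) (sumTo-+ n f g))
                            (+-interchange (sumTo n f) (sumTo n g) (f (suc n)) (g (suc n)))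

*-distribˡ-sumTo : ∀ n (a : ℤ) (f : ℕ → ℤ) → a * sumTo n f ≡ sumTo n (λ k → a * f k)
*-distribˡ-sumTo zero    a f = refl
*-distribˡ-sumTo (suc n) a f =
  trans (ZP.*-distribˡ-+ a (sumTo n f) (f (suc n))) (cong (_+ a * f (suc n)) (*-distribˡ-sumTo n a f))

*-distribʳ-sumTo : ∀ n (a : ℤ) (f : ℕ → ℤ) → sumTo n f * a ≡ sumTo n (λ k → f k * a)
*-distribʳ-sumTo n a f = trans (ZP.*-comm (sumTo n f) a)
  (trans (*-distribˡ-sumTo n a f) (sumTo-cong n (λ k _ → ZP.*-comm a (f k))))

sumTo-zero : ∀ n (f : ℕ → ℤ) → (∀ k → k ≤ℕ n → f k ≡ + 0) → sumTo n f ≡ + 0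
sumTo-zero zero    f f≡0 = f≡0 0 z≤n
sumTo-zero (suc n) f f≡0 =
  cong₂ _+_ (sumTo-zero n f (λ k k≤n → f≡0 k (NP.m≤n⇒m≤1+n k≤n))) (f≡0 (suc n) NP.≤-refl)

sumTo-comm : ∀ n m (F : ℕ → ℕ → ℤ) →
             sumTo n (λ i → sumTo m (F i)) ≡ sumTo m (λ j → sumTo n (λ i → F i j))
sumTo-comm zero    m F = refl
sumTo-comm (suc n) m F = trans (cong (_+ sumTo m (F (suc n))) (sumTo-comm n m F))
                               (sym (sumTo-+ m (λ j → sumTo n (λ i → F i j)) (F (suc n))))

sumTo-extend : ∀ n N (f : ℕ → ℤ) → n ≤ℕ N → (∀ k → n <ℕ k → f k ≡ + 0) → sumTo N f ≡ sumTo n f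
sumTo-extend n zero    f z≤n     _      = refl
sumTo-extend n (suc N) f n≤1+N f≡0 with n ℕ.≟ suc N
... | yes refl   = refl
... | no n≢1+N = trans (cong₂ _+_ (sumTo-extend n N f n≤N f≡0) (f≡0 (suc N) (s≤s n≤N)))
                       (ZP.+-identityʳ _)
  where
  n≤N : n ≤ℕ N
  n≤N = NP.≤-pred (NP.≤∧≢⇒< n≤1+N n≢1+N)

sumTo-single : ∀ n k (f : ℕ → ℤ) → k ≤ℕ n → (∀ j → j ≤ℕ n → j ≢ k → f j ≡ + 0) → sumTo n f ≡ f k
sumTo-single zero    zero f _ _ = refl
sumTo-single (suc n) k f k≤1+n f≡0 with k ℕ.≟ suc n
... | yes refl   = trans (cong (_+ f (suc n)) (sumTo-zero n f below)) (ZP.+-identityˡ _)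
  where
  below : ∀ j → j ≤ℕ n → f j ≡ + 0
  below j j≤n = f≡0 j (NP.m≤n⇒m≤1+n j≤n) (NP.<⇒≢ (s≤s j≤n))
... | no k≢1+n = trans (cong₂ _+_ (sumTo-single n k f k≤n (λ j j≤n → f≡0 j (NP.m≤n⇒m≤1+n j≤n)))
                                  (f≡0 (suc n) NP.≤-refl (k≢1+n ∘ sym)))
                       (ZP.+-identityʳ _)
  where
  k≤n : k ≤ℕ n
  k≤n = NP.≤-pred (NP.≤∧≢⇒< k≤1+n k≢1+n)

sumTo-agree-at : ∀ n k {f g : ℕ → ℤ} → k ≤ℕ n → (∀ j → j ≤ℕ n → j ≢ k → f j ≡ g j) →
                 sumTo n f ≡ sumTo n g → f k ≡ g k
sumTo-agree-at zero    zero _ _ eq = eq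
sumTo-agree-at (suc n) k {f} {g} k≤1+n f≡g eq with k ℕ.≟ suc n
... | yes refl   = ∙-cancelˡ (sumTo n f) (f (suc n)) (g (suc n))
                     (trans eq (cong (_+ g (suc n)) (sym (sumTo-cong n below))))
  where
  below : ∀ j → j ≤ℕ n → f j ≡ g j
  below j j≤n = f≡g j (NP.m≤n⇒m≤1+n j≤n) (NP.<⇒≢ (s≤s j≤n))
... | no k≢1+n = sumTo-agree-at n k (NP.≤-pred (NP.≤∧≢⇒< k≤1+n k≢1+n))
                   (λ j j≤n → f≡g j (NP.m≤n⇒m≤1+n j≤n))
                   (∙-cancelʳ (f (suc n)) (sumTo n f) (sumTo n g)
                     (trans eq (cong (λ x → sumTo n g + x) (sym (f≡g (suc n) NP.≤-refl (k≢1+n ∘ sym))))))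

-- Formal power series

module ≗-Reasoning = SetoidReasoning (ℕ →-setoid ℤ)

infixl 6 _⊕_
_⊕_ : Series → Series → Series
(a ⊕ b) n = a n + b n

infixr 8 _•_
_•_ : ℤ → Series → Series
(s • a) n = s * a n

zeroS : Series
zeroS _ = + 0

tailS : Series → Series
tailS a n = a (suc n)

⊕-cong : ∀ {a a' b b'} → a ≗ a' → b ≗ b' → a ⊕ b ≗ a' ⊕ b'
⊕-cong a≗a' b≗b' n = cong₂ _+_ (a≗a' n) (b≗b' n)

⊛-cong-upTo : ∀ n {a a' b b'} → (∀ m → m ≤ℕ n → a m ≡ a' m) → (∀ m → m ≤ℕ n → b m ≡ b' m) →
              (a ⊛ b) n ≡ (a' ⊛ b') n
⊛-cong-upTo n a≡a' b≡b' = sumTo-cong n (λ k k≤n → cong₂ _*_ (a≡a' k k≤n) (b≡b' (n ∸ k) (NP.m∸n≤m n k)))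

⊛-cong : ∀ {a a' b b'} → a ≗ a' → b ≗ b' → a ⊛ b ≗ a' ⊛ b'
⊛-cong a≗a' b≗b' n = ⊛-cong-upTo n (λ m _ → a≗a' m) (λ m _ → b≗b' m)

⊛-congˡ : ∀ a {b b'} → b ≗ b' → a ⊛ b ≗ a ⊛ b'
⊛-congˡ a = ⊛-cong {a} {a} (λ _ → refl)

⊛-congʳ : ∀ b {a a'} → a ≗ a' → a ⊛ b ≗ a' ⊛ b
⊛-congʳ b a≗a' = ⊛-cong {b = b} {b' = b} a≗a' (λ _ → refl)

⊛-suc : ∀ a b n → (a ⊛ b) (suc n) ≡ a 0 * b (suc n) + (tailS a ⊛ b) n
⊛-suc a b n = sumTo-shift n (λ k → a k * b (suc n ∸ k))

⊛-sucʳ : ∀ a b n → (a ⊛ b) (suc n) ≡ (a ⊛ tailS b) n + a (suc n) * b 0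
⊛-sucʳ a b n = cong₂ _+_ (sumTo-cong n (λ k k≤n → cong (λ i → a k * b i) (NP.+-∸-assoc 1 k≤n)))
                         (cong (λ i → a (suc n) * b i) (NP.n∸n≡0 n))

⊛-comm : ∀ a b → a ⊛ b ≗ b ⊛ a
⊛-comm a b zero    = ZP.*-comm (a 0) (b 0)
⊛-comm a b (suc n) = begin
  (a ⊛ b) (suc n)                     ≡⟨ ⊛-suc a b n ⟩
  a 0 * b (suc n) + (tailS a ⊛ b) n   ≡⟨ cong₂ _+_ (ZP.*-comm (a 0) _) (⊛-comm (tailS a) b n) ⟩
  b (suc n) * a 0 + (b ⊛ tailS a) n   ≡⟨ ZP.+-comm _ ((b ⊛ tailS a) n) ⟩
  (b ⊛ tailS a) n + b (suc n) * a 0   ≡⟨ ⊛-sucʳ b a n ⟨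
  (b ⊛ a) (suc n)                     ∎
  where open ≡-Reasoning

⊛-distribˡ : ∀ c a b → c ⊛ (a ⊕ b) ≗ c ⊛ a ⊕ c ⊛ b
⊛-distribˡ c a b n = trans (sumTo-cong n (λ k _ → ZP.*-distribˡ-+ (c k) (a (n ∸ k)) (b (n ∸ k))))
                           (sumTo-+ n _ _)

⊛-distribʳ : ∀ c a b → (a ⊕ b) ⊛ c ≗ a ⊛ c ⊕ b ⊛ c
⊛-distribʳ c a b n = trans (sumTo-cong n (λ k _ → ZP.*-distribʳ-+ (c (n ∸ k)) (a k) (b k)))
                           (sumTo-+ n _ _)

•-⊛ : ∀ s a b → (s • a) ⊛ b ≗ s • (a ⊛ b)
•-⊛ s a b n = trans (sumTo-cong n (λ k _ → ZP.*-assoc s (a k) (b (n ∸ k))))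
                    (sym (*-distribˡ-sumTo n s _))

⊛-• : ∀ s a b → a ⊛ (s • b) ≗ s • (a ⊛ b)
⊛-• s a b n = trans (sumTo-cong n (λ k _ → *-leftComm (a k) s (b (n ∸ k))))
                    (sym (*-distribˡ-sumTo n s _))

⊛-zeroˡ : ∀ a → zeroS ⊛ a ≗ zeroS
⊛-zeroˡ a n = sumTo-zero n _ (λ k _ → ZP.*-zeroˡ (a (n ∸ k)))

⊛-zeroʳ : ∀ a → a ⊛ zeroS ≗ zeroS
⊛-zeroʳ a n = sumTo-zero n _ (λ k _ → ZP.*-zeroʳ (a k))

⊛-identityˡ : ∀ a → oneS ⊛ a ≗ a
⊛-identityˡ a zero    = ZP.*-identityˡ (a 0)
⊛-identityˡ a (suc n) = trans (⊛-suc oneS a n)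
  (trans (cong₂ _+_ (ZP.*-identityˡ (a (suc n))) (⊛-zeroˡ a n)) (ZP.+-identityʳ (a (suc n))))

⊛-identityʳ : ∀ a → a ⊛ oneS ≗ a
⊛-identityʳ a n = trans (⊛-comm a oneS n) (⊛-identityˡ a n)

⊛-assoc : ∀ a b c → a ⊛ b ⊛ c ≗ a ⊛ (b ⊛ c)
⊛-assoc a b c zero    = ZP.*-assoc (a 0) (b 0) (c 0)
⊛-assoc a b c (suc n) = begin
  (a ⊛ b ⊛ c) (suc n)                                             ≡⟨ ⊛-suc (a ⊛ b) c n ⟩
  a 0 * b 0 * c (suc n) + (tailS (a ⊛ b) ⊛ c) n                   ≡⟨ cong (λ x → a 0 * b 0 * c (suc n) + x) tail-ab-c ⟩
  a 0 * b 0 * c (suc n) + (a 0 * (tailS b ⊛ c) n + (tailS a ⊛ (b ⊛ c)) n)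
    ≡⟨ regroup (a 0) (b 0) (c (suc n)) ((tailS b ⊛ c) n) ((tailS a ⊛ (b ⊛ c)) n) ⟩
  a 0 * (b 0 * c (suc n) + (tailS b ⊛ c) n) + (tailS a ⊛ (b ⊛ c)) n
    ≡⟨ cong (λ x → a 0 * x + (tailS a ⊛ (b ⊛ c)) n) (⊛-suc b c n) ⟨
  a 0 * (b ⊛ c) (suc n) + (tailS a ⊛ (b ⊛ c)) n                   ≡⟨ ⊛-suc a (b ⊛ c) n ⟨
  (a ⊛ (b ⊛ c)) (suc n)                                           ∎
  where
  open ≡-Reasoning
  regroup : ∀ x y z u v → x * y * z + (x * u + v) ≡ x * (y * z + u) + v
  regroup = solve-∀
  tail-ab-c : (tailS (a ⊛ b) ⊛ c) n ≡ a 0 * (tailS b ⊛ c) n + (tailS a ⊛ (b ⊛ c)) n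
  tail-ab-c = begin
    (tailS (a ⊛ b) ⊛ c) n                          ≡⟨ ⊛-congʳ c (⊛-suc a b) n ⟩
    ((a 0 • tailS b ⊕ tailS a ⊛ b) ⊛ c) n          ≡⟨ ⊛-distribʳ c (a 0 • tailS b) (tailS a ⊛ b) n ⟩
    ((a 0 • tailS b) ⊛ c) n + (tailS a ⊛ b ⊛ c) n  ≡⟨ cong₂ _+_ (•-⊛ (a 0) (tailS b) c n) (⊛-assoc (tailS a) b c n) ⟩
    a 0 * (tailS b ⊛ c) n + (tailS a ⊛ (b ⊛ c)) n  ∎

⊛-commutativeSemigroup : CommutativeSemigroup 0ℓ 0ℓ
⊛-commutativeSemigroup = record
  { Carrier = Series
  ; _≈_     = _≗_
  ; _∙_     = _⊛_
  ; isCommutativeSemigroup = record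
    { isSemigroup = record
      { isMagma = record { isEquivalence = Setoid.isEquivalence (ℕ →-setoid ℤ) ; ∙-cong = ⊛-cong }
      ; assoc   = ⊛-assoc
      }
    ; comm = ⊛-comm
    }
  }

open import Algebra.Properties.CommutativeSemigroup ⊛-commutativeSemigroup
  using () renaming (interchange to ⊛-interchange; x∙yz≈y∙xz to ⊛-leftComm)

X⊛-suc : ∀ a n → (X ⊛ a) (suc n) ≡ a n
X⊛-suc a n = trans (⊛-suc X a n) (trans (ZP.+-identityˡ _) (trans (⊛-congʳ a tailX≗1 n) (⊛-identityˡ a n)))
  where
  tailX≗1 : tailS X ≗ oneS
  tailX≗1 zero    = refl
  tailX≗1 (suc _) = refl

head-tail : ∀ a → a ≗ a 0 • oneS ⊕ X ⊛ tailS a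
head-tail a zero    = sym (trans (ZP.+-identityʳ _) (ZP.*-identityʳ (a 0)))
head-tail a (suc n) = sym (trans (cong₂ _+_ (ZP.*-zeroʳ (a 0)) (X⊛-suc (tailS a) n)) (ZP.+-identityˡ _))

X⊛-tail : ∀ a → a 0 ≡ + 0 → a ≗ X ⊛ tailS a
X⊛-tail a a0≡0 zero    = a0≡0
X⊛-tail a a0≡0 (suc n) = sym (X⊛-suc (tailS a) n)

⊛-head-tail : ∀ a b → a ⊛ b ≗ a 0 • b ⊕ X ⊛ (tailS a ⊛ b)
⊛-head-tail a b n = begin
  (a ⊛ b) n                                   ≡⟨ ⊛-congʳ b (head-tail a) n ⟩
  ((a 0 • oneS ⊕ X ⊛ tailS a) ⊛ b) n          ≡⟨ ⊛-distribʳ b (a 0 • oneS) (X ⊛ tailS a) n ⟩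
  ((a 0 • oneS) ⊛ b) n + (X ⊛ tailS a ⊛ b) n  ≡⟨ cong₂ _+_ (trans (•-⊛ (a 0) oneS b n) (cong (a 0 *_) (⊛-identityˡ b n)))
                                                           (⊛-assoc X (tailS a) b n) ⟩
  a 0 * b n + (X ⊛ (tailS a ⊛ b)) n           ∎
  where open ≡-Reasoning

⊛-cong-below : ∀ c {y y'} n → c 0 ≡ + 0 → (∀ m → m <ℕ n → y m ≡ y' m) → (c ⊛ y) n ≡ (c ⊛ y') n
⊛-cong-below c {y} {y'} n c0≡0 y≡y' = begin
  (c ⊛ y) n             ≡⟨ ⊛-congʳ y (X⊛-tail c c0≡0) n ⟩
  (X ⊛ tailS c ⊛ y) n   ≡⟨ ⊛-assoc X (tailS c) y n ⟩
  (X ⊛ (tailS c ⊛ y)) n ≡⟨ shifted n y≡y' ⟩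
  (X ⊛ (tailS c ⊛ y')) n ≡⟨ ⊛-assoc X (tailS c) y' n ⟨
  (X ⊛ tailS c ⊛ y') n  ≡⟨ ⊛-congʳ y' (X⊛-tail c c0≡0) n ⟨
  (c ⊛ y') n            ∎
  where
  open ≡-Reasoning
  shifted : ∀ n → (∀ m → m <ℕ n → y m ≡ y' m) → (X ⊛ (tailS c ⊛ y)) n ≡ (X ⊛ (tailS c ⊛ y')) n
  shifted zero    _     = refl
  shifted (suc n) y≡y' = trans (X⊛-suc (tailS c ⊛ y) n)
    (trans (⊛-cong-upTo n {tailS c} (λ _ _ → refl) (λ m m≤n → y≡y' m (s≤s m≤n))) (sym (X⊛-suc (tailS c ⊛ y') n)))

fixpoint-unique : ∀ u e {y y'} → e 0 ≡ + 0 → y ≗ u ⊕ e ⊛ y → y' ≗ u ⊕ e ⊛ y' → y ≗ y'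
fixpoint-unique u e {y} {y'} e0≡0 y-fix y'-fix = <-rec (λ n → y n ≡ y' n) step
  where
  step : ∀ n → (∀ {m} → m <ℕ n → y m ≡ y' m) → y n ≡ y' n
  step n rec = trans (y-fix n) (trans (cong (λ x → u n + x) (⊛-cong-below e n e0≡0 (λ m m<n → rec m<n))) (sym (y'-fix n)))

powS-cong : ∀ {a a'} k → a ≗ a' → powS a k ≗ powS a' k
powS-cong zero    _     = λ _ → refl
powS-cong (suc k) a≗a' = ⊛-cong a≗a' (powS-cong k a≗a')

powS-+ : ∀ a i j → powS a (i +ℕ j) ≗ powS a i ⊛ powS a j
powS-+ a zero    j n = sym (⊛-identityˡ (powS a j) n)
powS-+ a (suc i) j n = trans (⊛-congˡ a (powS-+ a i j) n) (sym (⊛-assoc a (powS a i) (powS a j) n))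

powS-⊛ : ∀ a b k → powS (a ⊛ b) k ≗ powS a k ⊛ powS b k
powS-⊛ a b zero    n = sym (⊛-identityˡ oneS n)
powS-⊛ a b (suc k) n = trans (⊛-congˡ (a ⊛ b) (powS-⊛ a b k) n) (⊛-interchange a b (powS a k) (powS b k) n)

powS-head : ∀ a k → a 0 ≡ + 1 → powS a k 0 ≡ + 1
powS-head a zero    _      = refl
powS-head a (suc k) a0≡1 = cong₂ _*_ a0≡1 (powS-head a k a0≡1)

powS-vanish-below : ∀ a k n → a 0 ≡ + 0 → n <ℕ k → powS a k n ≡ + 0
powS-vanish-below a (suc k) zero    a0≡0 _          = cong (_* powS a k 0) a0≡0
powS-vanish-below a (suc k) (suc n) a0≡0 (s≤s n<k) = begin
  (a ⊛ powS a k) (suc n)               ≡⟨ ⊛-suc a (powS a k) n ⟩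
  a 0 * powS a k (suc n) + (tailS a ⊛ powS a k) n
    ≡⟨ cong₂ _+_ (cong (_* powS a k (suc n)) a0≡0)
                 (sumTo-zero n _ (λ j _ → trans (cong (tailS a j *_) (powS-vanish-below a k (n ∸ j) a0≡0
                                                                        (NP.≤-<-trans (NP.m∸n≤m n j) n<k)))
                                                (ZP.*-zeroʳ (tailS a j)))) ⟩
  + 0                                   ∎
  where open ≡-Reasoning

powS-X-shift : ∀ k m b → (powS X k ⊛ b) (k +ℕ m) ≡ b m
powS-X-shift zero    m b = ⊛-identityˡ b m
powS-X-shift (suc k) m b = trans (⊛-assoc X (powS X k) b (suc (k +ℕ m)))
                                 (trans (X⊛-suc (powS X k ⊛ b) (k +ℕ m)) (powS-X-shift k m b))

powS-X-below : ∀ k n b → n <ℕ k → (powS X k ⊛ b) n ≡ + 0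
powS-X-below (suc k) zero    b _          = refl
powS-X-below (suc k) (suc n) b (s≤s n<k) = trans (⊛-assoc X (powS X k) b (suc n))
                                                 (trans (X⊛-suc (powS X k ⊛ b) n) (powS-X-below k n b n<k))

-- Derivatives

deriv-cong : ∀ {a b} → a ≗ b → deriv a ≗ deriv b
deriv-cong a≗b n = cong (+ suc n *_) (a≗b (suc n))

deriv-⊕ : ∀ a b → deriv (a ⊕ b) ≗ deriv a ⊕ deriv b
deriv-⊕ a b n = ZP.*-distribˡ-+ (+ suc n) (a (suc n)) (b (suc n))

deriv-• : ∀ s a → deriv (s • a) ≗ s • deriv a
deriv-• s a n = *-leftComm (+ suc n) s (a (suc n))

deriv-oneS : deriv oneS ≗ zeroS
deriv-oneS n = ZP.*-zeroʳ (+ suc n)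

[1+y]*x≡x+y*x : ∀ x y → (+ 1 + y) * x ≡ x + y * x
[1+y]*x≡x+y*x = solve-∀

deriv-X⊛ : ∀ u → deriv (X ⊛ u) ≗ u ⊕ X ⊛ deriv u
deriv-X⊛ u zero    = trans (cong (+ 1 *_) (X⊛-suc u 0)) (trans (ZP.*-identityˡ (u 0)) (sym (ZP.+-identityʳ (u 0))))
deriv-X⊛ u (suc m) = trans (cong (+ suc (suc m) *_) (X⊛-suc u (suc m)))
  (trans ([1+y]*x≡x+y*x (u (suc m)) (+ suc m)) (cong (λ x → u (suc m) + x) (sym (X⊛-suc (deriv u) m))))

deriv-head-tail : ∀ a → deriv a ≗ tailS a ⊕ X ⊛ deriv (tailS a)
deriv-head-tail a zero    = trans (ZP.*-identityˡ (a 1)) (sym (ZP.+-identityʳ (a 1)))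
deriv-head-tail a (suc m) = trans ([1+y]*x≡x+y*x (a (suc (suc m))) (+ suc m))
  (cong (λ x → a (suc (suc m)) + x) (sym (X⊛-suc (deriv (tailS a)) m)))

deriv-⊛ : ∀ a b → deriv (a ⊛ b) ≗ deriv a ⊛ b ⊕ a ⊛ deriv b
deriv-⊛ a b n = <-rec Leibniz step n a b
  where
  Leibniz : ℕ → Set
  Leibniz n = ∀ a b → deriv (a ⊛ b) n ≡ (deriv a ⊛ b ⊕ a ⊛ deriv b) n
  step : ∀ n → (∀ {m} → m <ℕ n → Leibniz m) → Leibniz n
  step n rec a b = begin
    deriv (a ⊛ b) n
      ≡⟨ deriv-cong (⊛-head-tail a b) n ⟩
    deriv (a 0 • b ⊕ X ⊛ (a' ⊛ b)) n
      ≡⟨ deriv-⊕ (a 0 • b) (X ⊛ (a' ⊛ b)) n ⟩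
    deriv (a 0 • b) n + deriv (X ⊛ (a' ⊛ b)) n
      ≡⟨ cong₂ _+_ (deriv-• (a 0) b n) (deriv-X⊛ (a' ⊛ b) n) ⟩
    a 0 * deriv b n + ((a' ⊛ b) n + (X ⊛ deriv (a' ⊛ b)) n)
      ≡⟨ cong (λ x → a 0 * deriv b n + ((a' ⊛ b) n + x)) Leibniz-tail ⟩
    a 0 * deriv b n + ((a' ⊛ b) n + ((X ⊛ (deriv a' ⊛ b)) n + (X ⊛ (a' ⊛ deriv b)) n))
      ≡⟨ regroup (a 0 * deriv b n) ((a' ⊛ b) n) ((X ⊛ (deriv a' ⊛ b)) n) ((X ⊛ (a' ⊛ deriv b)) n) ⟩
    ((a' ⊛ b) n + (X ⊛ (deriv a' ⊛ b)) n) + (a 0 * deriv b n + (X ⊛ (a' ⊛ deriv b)) n)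
      ≡⟨ cong₂ _+_ (sym deriv-a⊛b) (sym (⊛-head-tail a (deriv b) n)) ⟩
    (deriv a ⊛ b) n + (a ⊛ deriv b) n
      ∎
    where
    open ≡-Reasoning
    a' : Series
    a' = tailS a
    regroup : ∀ p q r s → p + (q + (r + s)) ≡ (q + r) + (p + s)
    regroup = solve-∀
    Leibniz-tail : (X ⊛ deriv (a' ⊛ b)) n ≡ (X ⊛ (deriv a' ⊛ b)) n + (X ⊛ (a' ⊛ deriv b)) n
    Leibniz-tail = trans (⊛-cong-below X n refl (λ m m<n → rec m<n a' b))
                         (⊛-distribˡ X (deriv a' ⊛ b) (a' ⊛ deriv b) n)
    deriv-a⊛b : (deriv a ⊛ b) n ≡ (a' ⊛ b) n + (X ⊛ (deriv a' ⊛ b)) n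
    deriv-a⊛b = trans (⊛-congʳ b (deriv-head-tail a) n)
      (trans (⊛-distribʳ b a' (X ⊛ deriv a') n) (cong (λ x → (a' ⊛ b) n + x) (⊛-assoc X (deriv a') b n)))

deriv-powS : ∀ a k → deriv (powS a (suc k)) ≗ (+ suc k) • (powS a k ⊛ deriv a)
deriv-powS a zero n = begin
  deriv (a ⊛ oneS) n                          ≡⟨ deriv-⊛ a oneS n ⟩
  (deriv a ⊛ oneS) n + (a ⊛ deriv oneS) n     ≡⟨ cong₂ _+_ (⊛-comm (deriv a) oneS n)
                                                           (trans (⊛-congˡ a deriv-oneS n) (⊛-zeroʳ a n)) ⟩
  (oneS ⊛ deriv a) n + + 0                    ≡⟨ ZP.+-identityʳ _ ⟩
  (oneS ⊛ deriv a) n                          ≡⟨ ZP.*-identityˡ _ ⟨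
  + 1 * (oneS ⊛ deriv a) n                    ∎
  where open ≡-Reasoning
deriv-powS a (suc k) n = begin
  deriv (a ⊛ powS a (suc k)) n
    ≡⟨ deriv-⊛ a (powS a (suc k)) n ⟩
  (deriv a ⊛ powS a (suc k)) n + (a ⊛ deriv (powS a (suc k))) n
    ≡⟨ cong₂ _+_ (⊛-comm (deriv a) (powS a (suc k)) n) (⊛-congˡ a (deriv-powS a k) n) ⟩
  Q + (a ⊛ (+ suc k) • (powS a k ⊛ deriv a)) n
    ≡⟨ cong (λ x → Q + x) (trans (⊛-• (+ suc k) a (powS a k ⊛ deriv a) n)
                                 (cong (+ suc k *_) (sym (⊛-assoc a (powS a k) (deriv a) n)))) ⟩
  Q + + suc k * Q
    ≡⟨ [1+y]*x≡x+y*x Q (+ suc k) ⟨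
  + suc (suc k) * Q
    ∎
  where
  open ≡-Reasoning
  Q : ℤ
  Q = (powS a (suc k) ⊛ deriv a) n

-- Composition

module Composition (c : Series) (c0≡0 : c 0 ≡ + 0) where

  vanish-beyond : ∀ (a : Series) n k → n <ℕ k → a k * powS c k n ≡ + 0
  vanish-beyond a n k n<k = trans (cong (a k *_) (powS-vanish-below c k n c0≡0 n<k)) (ZP.*-zeroʳ (a k))

  ∘ₛ-extend : ∀ a n N → n ≤ℕ N → sumTo N (λ k → a k * powS c k n) ≡ (a ∘ₛ c) n
  ∘ₛ-extend a n N n≤N = sumTo-extend n N (λ k → a k * powS c k n) n≤N (vanish-beyond a n)

  ∘ₛ-cong : ∀ {a a'} → a ≗ a' → a ∘ₛ c ≗ a' ∘ₛ c
  ∘ₛ-cong a≗a' n = sumTo-cong n (λ k _ → cong (_* powS c k n) (a≗a' k))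

  ∘ₛ-⊕ : ∀ a b → (a ⊕ b) ∘ₛ c ≗ a ∘ₛ c ⊕ b ∘ₛ c
  ∘ₛ-⊕ a b n = trans (sumTo-cong n (λ k _ → ZP.*-distribʳ-+ (powS c k n) (a k) (b k))) (sumTo-+ n _ _)

  ∘ₛ-• : ∀ s a → (s • a) ∘ₛ c ≗ s • (a ∘ₛ c)
  ∘ₛ-• s a n = trans (sumTo-cong n (λ k _ → ZP.*-assoc s (a k) (powS c k n))) (sym (*-distribˡ-sumTo n s _))

  ∘ₛ-oneS : oneS ∘ₛ c ≗ oneS
  ∘ₛ-oneS zero    = refl
  ∘ₛ-oneS (suc n) = trans (sumTo-shift n _)
    (cong₂ _+_ (ZP.*-identityˡ (powS c 0 (suc n))) (sumTo-zero n _ (λ k _ → ZP.*-zeroˡ (powS c (suc k) (suc n)))))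

  ∘ₛ-X : X ∘ₛ c ≗ c
  ∘ₛ-X zero    = sym c0≡0
  ∘ₛ-X (suc n) = begin
    (X ∘ₛ c) (suc n)                                      ≡⟨ sumTo-shift n _ ⟩
    X 0 * oneS (suc n) + sumTo n (λ k → X (suc k) * powS c (suc k) (suc n))
      ≡⟨ ZP.+-identityˡ _ ⟩
    sumTo n (λ k → X (suc k) * powS c (suc k) (suc n))    ≡⟨ sumTo-single n 0 _ z≤n higher-vanish ⟩
    + 1 * (c ⊛ oneS) (suc n)                              ≡⟨ ZP.*-identityˡ _ ⟩
    (c ⊛ oneS) (suc n)                                    ≡⟨ ⊛-identityʳ c (suc n) ⟩
    c (suc n)                                             ∎
    where
    open ≡-Reasoning
    higher-vanish : ∀ j → j ≤ℕ n → j ≢ 0 → X (suc j) * powS c (suc j) (suc n) ≡ + 0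
    higher-vanish zero    _ j≢0 = ⊥-elim (j≢0 refl)
    higher-vanish (suc j) _ _   = ZP.*-zeroˡ (powS c (suc (suc j)) (suc n))

  ∘ₛ-head-tail : ∀ a → a ∘ₛ c ≗ a 0 • oneS ⊕ c ⊛ (tailS a ∘ₛ c)
  ∘ₛ-head-tail a n = begin
    (a ∘ₛ c) n                                           ≡⟨ ∘ₛ-extend a n (suc n) (NP.n≤1+n n) ⟨
    sumTo (suc n) (λ k → a k * powS c k n)               ≡⟨ sumTo-shift n _ ⟩
    a 0 * oneS n + sumTo n (λ j → a (suc j) * powS c (suc j) n)
      ≡⟨ cong (λ x → a 0 * oneS n + x) (sym c⊛tail) ⟩
    a 0 * oneS n + (c ⊛ (tailS a ∘ₛ c)) n                ∎
    where
    open ≡-Reasoning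
    c⊛tail : (c ⊛ (tailS a ∘ₛ c)) n ≡ sumTo n (λ j → a (suc j) * powS c (suc j) n)
    c⊛tail = begin
      sumTo n (λ m → c m * (tailS a ∘ₛ c) (n ∸ m))
        ≡⟨ sumTo-cong n (λ m _ → cong (c m *_) (sym (∘ₛ-extend (tailS a) (n ∸ m) n (NP.m∸n≤m n m)))) ⟩
      sumTo n (λ m → c m * sumTo n (λ j → a (suc j) * powS c j (n ∸ m)))
        ≡⟨ sumTo-cong n (λ m _ → *-distribˡ-sumTo n (c m) _) ⟩
      sumTo n (λ m → sumTo n (λ j → c m * (a (suc j) * powS c j (n ∸ m))))
        ≡⟨ sumTo-comm n n _ ⟩
      sumTo n (λ j → sumTo n (λ m → c m * (a (suc j) * powS c j (n ∸ m))))
        ≡⟨ sumTo-cong n (λ j _ → trans (sumTo-cong n (λ m _ → *-leftComm (c m) (a (suc j)) _))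
                                       (sym (*-distribˡ-sumTo n (a (suc j)) _))) ⟩
      sumTo n (λ j → a (suc j) * powS c (suc j) n)
        ∎

  ∘ₛ-⊛ : ∀ a b → (a ⊛ b) ∘ₛ c ≗ a ∘ₛ c ⊛ b ∘ₛ c
  ∘ₛ-⊛ a b n = <-rec Multiplicative step n a b
    where
    Multiplicative : ℕ → Set
    Multiplicative n = ∀ a b → ((a ⊛ b) ∘ₛ c) n ≡ (a ∘ₛ c ⊛ b ∘ₛ c) n
    step : ∀ n → (∀ {m} → m <ℕ n → Multiplicative m) → Multiplicative n
    step n rec a b = begin
      ((a ⊛ b) ∘ₛ c) n                                   ≡⟨ ∘ₛ-head-tail (a ⊛ b) n ⟩
      (a ⊛ b) 0 * oneS n + (c ⊛ (tailS (a ⊛ b) ∘ₛ c)) n  ≡⟨ cong (λ x → (a ⊛ b) 0 * oneS n + x) lhs-tail ⟩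
      (a ⊛ b) 0 * oneS n + (a 0 * (c ⊛ B') n + (c ⊛ (A' ⊛ B)) n)
        ≡⟨ regroup (a 0) (b 0) (oneS n) ((c ⊛ B') n) ((c ⊛ (A' ⊛ B)) n) ⟩
      a 0 * (b 0 * oneS n + (c ⊛ B') n) + (c ⊛ (A' ⊛ B)) n
        ≡⟨ cong (λ x → a 0 * x + (c ⊛ (A' ⊛ B)) n) (sym (∘ₛ-head-tail b n)) ⟩
      a 0 * B n + (c ⊛ (A' ⊛ B)) n                       ≡⟨ rhs ⟨
      (a ∘ₛ c ⊛ B) n                                     ∎
      where
      open ≡-Reasoning
      A' B' B : Series
      A' = tailS a ∘ₛ c
      B' = tailS b ∘ₛ c
      B  = b ∘ₛ c
      regroup : ∀ x y o u v → x * y * o + (x * u + v) ≡ x * (y * o + u) + v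
      regroup = solve-∀
      tail-ab : tailS (a ⊛ b) ∘ₛ c ≗ a 0 • B' ⊕ (tailS a ⊛ b) ∘ₛ c
      tail-ab m = trans (∘ₛ-cong (⊛-suc a b) m)
        (trans (∘ₛ-⊕ (a 0 • tailS b) (tailS a ⊛ b) m) (cong (_+ ((tailS a ⊛ b) ∘ₛ c) m) (∘ₛ-• (a 0) (tailS b) m)))
      lhs-tail : (c ⊛ (tailS (a ⊛ b) ∘ₛ c)) n ≡ a 0 * (c ⊛ B') n + (c ⊛ (A' ⊛ B)) n
      lhs-tail = begin
        (c ⊛ (tailS (a ⊛ b) ∘ₛ c)) n          ≡⟨ ⊛-congˡ c tail-ab n ⟩
        (c ⊛ (a 0 • B' ⊕ (tailS a ⊛ b) ∘ₛ c)) n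
          ≡⟨ ⊛-cong-below c n c0≡0 (λ m m<n → cong (λ x → a 0 * B' m + x) (rec m<n (tailS a) b)) ⟩
        (c ⊛ (a 0 • B' ⊕ A' ⊛ B)) n            ≡⟨ ⊛-distribˡ c (a 0 • B') (A' ⊛ B) n ⟩
        (c ⊛ a 0 • B') n + (c ⊛ (A' ⊛ B)) n    ≡⟨ cong (_+ (c ⊛ (A' ⊛ B)) n) (⊛-• (a 0) c B' n) ⟩
        a 0 * (c ⊛ B') n + (c ⊛ (A' ⊛ B)) n    ∎
      rhs : (a ∘ₛ c ⊛ B) n ≡ a 0 * B n + (c ⊛ (A' ⊛ B)) n
      rhs = begin
        (a ∘ₛ c ⊛ B) n                          ≡⟨ ⊛-congʳ B (∘ₛ-head-tail a) n ⟩
        ((a 0 • oneS ⊕ c ⊛ A') ⊛ B) n           ≡⟨ ⊛-distribʳ B (a 0 • oneS) (c ⊛ A') n ⟩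
        ((a 0 • oneS) ⊛ B) n + (c ⊛ A' ⊛ B) n   ≡⟨ cong₂ _+_ (trans (•-⊛ (a 0) oneS B n) (cong (a 0 *_) (⊛-identityˡ B n)))
                                                             (⊛-assoc c A' B n) ⟩
        a 0 * B n + (c ⊛ (A' ⊛ B)) n            ∎

  ∘ₛ-powS : ∀ a k → powS a k ∘ₛ c ≗ powS (a ∘ₛ c) k
  ∘ₛ-powS a zero    = ∘ₛ-oneS
  ∘ₛ-powS a (suc k) n = trans (∘ₛ-⊛ a (powS a k) n) (⊛-congˡ (a ∘ₛ c) (∘ₛ-powS a k) n)

  deriv-∘ₛ : ∀ a → deriv (a ∘ₛ c) ≗ deriv a ∘ₛ c ⊛ deriv c
  deriv-∘ₛ a n = <-rec Chain step n a
    where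
    Chain : ℕ → Set
    Chain n = ∀ a → deriv (a ∘ₛ c) n ≡ (deriv a ∘ₛ c ⊛ deriv c) n
    step : ∀ n → (∀ {m} → m <ℕ n → Chain m) → Chain n
    step n rec a = begin
      deriv (a ∘ₛ c) n                              ≡⟨ deriv-cong (∘ₛ-head-tail a) n ⟩
      deriv (a 0 • oneS ⊕ c ⊛ A') n                ≡⟨ deriv-⊕ (a 0 • oneS) (c ⊛ A') n ⟩
      deriv (a 0 • oneS) n + deriv (c ⊛ A') n       ≡⟨ cong₂ _+_ deriv-const (deriv-⊛ c A' n) ⟩
      + 0 + ((deriv c ⊛ A') n + (c ⊛ deriv A') n)   ≡⟨ ZP.+-identityˡ _ ⟩
      (deriv c ⊛ A') n + (c ⊛ deriv A') n
        ≡⟨ cong₂ _+_ (⊛-comm (deriv c) A' n) (⊛-cong-below c n c0≡0 (λ m m<n → rec m<n (tailS a))) ⟩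
      (A' ⊛ deriv c) n + (c ⊛ (D' ⊛ deriv c)) n     ≡⟨ cong (λ x → (A' ⊛ deriv c) n + x) (sym (⊛-assoc c D' (deriv c) n)) ⟩
      (A' ⊛ deriv c) n + (c ⊛ D' ⊛ deriv c) n       ≡⟨ ⊛-distribʳ (deriv c) A' (c ⊛ D') n ⟨
      ((A' ⊕ c ⊛ D') ⊛ deriv c) n                   ≡⟨ ⊛-congʳ (deriv c) deriv-a∘c n ⟨
      (deriv a ∘ₛ c ⊛ deriv c) n                    ∎
      where
      open ≡-Reasoning
      A' D' : Series
      A' = tailS a ∘ₛ c
      D' = deriv (tailS a) ∘ₛ c
      deriv-const : deriv (a 0 • oneS) n ≡ + 0
      deriv-const = trans (deriv-• (a 0) oneS n) (trans (cong (a 0 *_) (deriv-oneS n)) (ZP.*-zeroʳ (a 0)))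
      deriv-a∘c : deriv a ∘ₛ c ≗ A' ⊕ c ⊛ D'
      deriv-a∘c m = trans (∘ₛ-cong (deriv-head-tail a) m)
        (trans (∘ₛ-⊕ (tailS a) (X ⊛ deriv (tailS a)) m)
               (cong (λ x → A' m + x) (trans (∘ₛ-⊛ X (deriv (tailS a)) m) (⊛-congʳ D' ∘ₛ-X m))))

oneMinus-involutive : ∀ a → oneS ⊕ (- + 1) • oneMinus a ≗ a
oneMinus-involutive a zero    = 1+[-1]*[1-x]≡x (a 0)
  where
  1+[-1]*[1-x]≡x : ∀ x → + 1 + (- + 1) * (+ 1 + - x) ≡ x
  1+[-1]*[1-x]≡x = solve-∀
oneMinus-involutive a (suc n) = trans (ZP.+-identityˡ _) ([-1]*[-x]≡x (a (suc n)))
  where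
  [-1]*[-x]≡x : ∀ x → (- + 1) * (- x) ≡ x
  [-1]*[-x]≡x = solve-∀

geometric : Series
geometric _ = + 1

geometric-sum : (oneS ⊕ (- + 1) • X) ⊛ geometric ≗ oneS
geometric-sum n = begin
  ((oneS ⊕ (- + 1) • X) ⊛ geometric) n                ≡⟨ ⊛-distribʳ geometric oneS ((- + 1) • X) n ⟩
  (oneS ⊛ geometric) n + ((- + 1) • X ⊛ geometric) n  ≡⟨ cong₂ _+_ (⊛-identityˡ geometric n) (•-⊛ (- + 1) X geometric n) ⟩
  + 1 + (- + 1) * (X ⊛ geometric) n                   ≡⟨ telescope n ⟩
  oneS n                                              ∎
  where
  open ≡-Reasoning
  telescope : ∀ n → + 1 + (- + 1) * (X ⊛ geometric) n ≡ oneS n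
  telescope zero    = refl
  telescope (suc n) = cong (λ x → + 1 + (- + 1) * x) (X⊛-suc geometric n)

invS-inverseʳ : ∀ a → a 0 ≡ + 1 → a ⊛ invS a ≗ oneS
invS-inverseʳ a a0≡1 = begin
  a ⊛ invS a                                     ≈⟨ ⊛-cong (λ n → sym (oneMinus-involutive a n)) invS≗geometric∘b ⟩
  (oneS ⊕ (- + 1) • b) ⊛ geometric ∘ₛ b          ≈⟨ ⊛-congʳ (geometric ∘ₛ b) 1-X∘b ⟨
  (oneS ⊕ (- + 1) • X) ∘ₛ b ⊛ geometric ∘ₛ b     ≈⟨ ∘ₛ-⊛ (oneS ⊕ (- + 1) • X) geometric ⟨
  ((oneS ⊕ (- + 1) • X) ⊛ geometric) ∘ₛ b        ≈⟨ ∘ₛ-cong geometric-sum ⟩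
  oneS ∘ₛ b                                      ≈⟨ ∘ₛ-oneS ⟩
  oneS                                           ∎
  where
  open ≗-Reasoning
  b : Series
  b = oneMinus a
  open Composition b (cong (λ x → + 1 + - x) a0≡1)
  invS≗geometric∘b : invS a ≗ geometric ∘ₛ b
  invS≗geometric∘b n = sumTo-cong n (λ k _ → sym (ZP.*-identityˡ _))
  1-X∘b : (oneS ⊕ (- + 1) • X) ∘ₛ b ≗ oneS ⊕ (- + 1) • b
  1-X∘b n = trans (∘ₛ-⊕ oneS ((- + 1) • X) n)
                  (cong₂ _+_ (∘ₛ-oneS n) (trans (∘ₛ-• (- + 1) X n) (cong ((- + 1) *_) (∘ₛ-X n))))

-- Lower triangular matrices

infix 4 _≋_
_≋_ : Matrix → Matrix → Set
A ≋ B = ∀ n k → A n k ≡ B n k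

Unitriangular : Matrix → Set
Unitriangular A = LowerTri A × (∀ n → A n n ≡ + 1)

·-congˡ : ∀ A {B B'} → B ≋ B' → A · B ≋ A · B'
·-congˡ A B≋B' n k = sumTo-cong n (λ j _ → cong (A n j *_) (B≋B' j k))

·-congʳ : ∀ B {A A'} → A ≋ A' → A · B ≋ A' · B
·-congʳ B A≋A' n k = sumTo-cong n (λ j _ → cong (_* B j k) (A≋A' n j))

·-assoc : ∀ A B C → LowerTri B → (A · B) · C ≋ A · (B · C)
·-assoc A B C lowB n k = begin
  sumTo n (λ j → sumTo n (λ i → A n i * B i j) * C j k)
    ≡⟨ sumTo-cong n (λ j _ → *-distribʳ-sumTo n (C j k) _) ⟩
  sumTo n (λ j → sumTo n (λ i → A n i * B i j * C j k))
    ≡⟨ sumTo-comm n n _ ⟩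
  sumTo n (λ i → sumTo n (λ j → A n i * B i j * C j k))
    ≡⟨ sumTo-cong n (λ i _ → trans (sumTo-cong n (λ j _ → ZP.*-assoc (A n i) (B i j) (C j k)))
                                   (sym (*-distribˡ-sumTo n (A n i) _))) ⟩
  sumTo n (λ i → A n i * sumTo n (λ j → B i j * C j k))
    ≡⟨ sumTo-cong n (λ i i≤n → cong (A n i *_) (sumTo-extend i n _ i≤n
                                  (λ j i<j → trans (cong (_* C j k) (lowB i j i<j)) (ZP.*-zeroˡ (C j k))))) ⟩
  sumTo n (λ i → A n i * sumTo i (λ j → B i j * C j k))
    ∎
  where open ≡-Reasoning

LowerTri-· : ∀ A {B} → LowerTri B → LowerTri (A · B)
LowerTri-· A {B} lowB n k n<k =
  sumTo-zero n _ (λ j j≤n → trans (cong (A n j *_) (lowB j k (NP.≤-<-trans j≤n n<k))) (ZP.*-zeroʳ (A n j)))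

δ-diagonal : ∀ n → δ n n ≡ + 1
δ-diagonal zero    = refl
δ-diagonal (suc n) = δ-diagonal n

δ-offDiagonal : ∀ n k → n ≢ k → δ n k ≡ + 0
δ-offDiagonal zero    zero    n≢k = ⊥-elim (n≢k refl)
δ-offDiagonal zero    (suc k) _   = refl
δ-offDiagonal (suc n) zero    _   = refl
δ-offDiagonal (suc n) (suc k) n≢k = δ-offDiagonal n k (n≢k ∘ cong suc)

LowerTri-δ : LowerTri δ
LowerTri-δ n k n<k = δ-offDiagonal n k (NP.<⇒≢ n<k)

·-identityˡ : ∀ A → δ · A ≋ A
·-identityˡ A n k = begin
  (δ · A) n k    ≡⟨ sumTo-single n n _ NP.≤-refl
                      (λ j _ j≢n → trans (cong (_* A j k) (δ-offDiagonal n j (j≢n ∘ sym))) (ZP.*-zeroˡ (A j k))) ⟩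
  δ n n * A n k  ≡⟨ cong (_* A n k) (δ-diagonal n) ⟩
  + 1 * A n k    ≡⟨ ZP.*-identityˡ (A n k) ⟩
  A n k          ∎
  where open ≡-Reasoning

·-identityʳ : ∀ A → LowerTri A → A · δ ≋ A
·-identityʳ A lowA n k with k NP.≤? n
... | yes k≤n = begin
  (A · δ) n k    ≡⟨ sumTo-single n k _ k≤n
                      (λ j _ j≢k → trans (cong (A n j *_) (δ-offDiagonal j k j≢k)) (ZP.*-zeroʳ (A n j))) ⟩
  A n k * δ k k  ≡⟨ cong (A n k *_) (δ-diagonal k) ⟩
  A n k * + 1    ≡⟨ ZP.*-identityʳ (A n k) ⟩
  A n k          ∎
  where open ≡-Reasoning
... | no k≰n = trans (LowerTri-· A LowerTri-δ n k n<k) (sym (lowA n k n<k))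
  where
  n<k : n <ℕ k
  n<k = NP.≰⇒> k≰n

-- Entries are determined from the diagonal outwards: descending induction on the column.
·-cancelʳ : ∀ {P Q R} → Unitriangular R → LowerTri P → LowerTri Q → P · R ≋ Q · R → P ≋ Q
·-cancelʳ {P} {Q} {R} (lowR , diagR) lowP lowQ PR≋QR n k with k NP.≤? n
... | no k≰n = trans (lowP n k (NP.≰⇒> k≰n)) (sym (lowQ n k (NP.≰⇒> k≰n)))
... | yes k≤n = <-rec AgreeAt step (n ∸ k) k refl k≤n
  where
  AgreeAt : ℕ → Set
  AgreeAt d = ∀ i → n ∸ i ≡ d → i ≤ℕ n → P n i ≡ Q n i
  step : ∀ d → (∀ {d'} → d' <ℕ d → AgreeAt d') → AgreeAt d
  step d rec i n∸i≡d i≤n = begin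
    P n i          ≡⟨ ZP.*-identityʳ (P n i) ⟨
    P n i * + 1    ≡⟨ cong (P n i *_) (diagR i) ⟨
    P n i * R i i  ≡⟨ sumTo-agree-at n i i≤n other-terms (PR≋QR n i) ⟩
    Q n i * R i i  ≡⟨ cong (Q n i *_) (diagR i) ⟩
    Q n i * + 1    ≡⟨ ZP.*-identityʳ (Q n i) ⟩
    Q n i          ∎
    where
    open ≡-Reasoning
    other-terms : ∀ j → j ≤ℕ n → j ≢ i → P n j * R j i ≡ Q n j * R j i
    other-terms j j≤n j≢i with NP.<-cmp j i
    ... | tri< j<i _ _ rewrite lowR j i j<i = trans (ZP.*-zeroʳ (P n j)) (sym (ZP.*-zeroʳ (Q n j)))
    ... | tri≈ _ j≡i _ = ⊥-elim (j≢i j≡i)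
    ... | tri> _ _ i<j = cong (_* R j i) (rec (subst (n ∸ j <ℕ_) n∸i≡d (NP.∸-monoʳ-< i<j j≤n)) j refl j≤n)

left-inverse⇒right-inverse : ∀ {A M} → Unitriangular A → LowerTri M → M · A ≋ δ → A · M ≋ δ
left-inverse⇒right-inverse {A} {M} uA@(lowA , _) lowM MA≋δ =
  ·-cancelʳ uA (LowerTri-· A lowM) LowerTri-δ AMA≋δA
  where
  AMA≋δA : (A · M) · A ≋ δ · A
  AMA≋δA n k = trans (·-assoc A M A lowM n k)
    (trans (·-congˡ A MA≋δ n k) (trans (·-identityʳ A lowA n k) (sym (·-identityˡ A n k))))

-- M T R = M A = 1 = N R, so M T = N.
left-inverse-sandwich : ∀ {A R T M N} → Unitriangular A → Unitriangular R → LowerTri T → LowerTri M → LowerTri N →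
                        A ≋ T · R → M · A ≋ δ → N · R ≋ δ → M · (T · A) · M ≋ N
left-inverse-sandwich {A} {R} {T} {M} {N} uA uR lowT lowM lowN A≋TR MA≋δ NR≋δ n k = begin
  (M · (T · A) · M) n k  ≡⟨ ·-congʳ M (λ i j → sym (·-assoc M T A lowT i j)) n k ⟩
  (M · T · A · M) n k    ≡⟨ ·-assoc (M · T) A M (proj₁ uA) n k ⟩
  (M · T · (A · M)) n k  ≡⟨ ·-congˡ (M · T) (left-inverse⇒right-inverse uA lowM MA≋δ) n k ⟩
  (M · T · δ) n k        ≡⟨ ·-identityʳ (M · T) lowMT n k ⟩
  (M · T) n k            ≡⟨ ·-cancelʳ uR lowMT lowN MTR≋NR n k ⟩
  N n k                  ∎
  where
  open ≡-Reasoning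
  lowMT : LowerTri (M · T)
  lowMT = LowerTri-· M lowT
  MTR≋NR : M · T · R ≋ N · R
  MTR≋NR i j = trans (·-assoc M T R lowT i j)
    (trans (·-congˡ M (λ a b → sym (A≋TR a b)) i j) (trans (MA≋δ i j) (sym (NR≋δ i j))))

-- Riordan arrays

toeplitz : Series → Matrix
toeplitz t zero    zero    = t 0
toeplitz t zero    (suc k) = + 0
toeplitz t (suc n) zero    = t (suc n)
toeplitz t (suc n) (suc k) = toeplitz t n k

toeplitz-entry : ∀ t n k → k ≤ℕ n → toeplitz t n k ≡ t (n ∸ k)
toeplitz-entry t zero    zero    _         = refl
toeplitz-entry t (suc n) zero    _         = refl
toeplitz-entry t (suc n) (suc k) (s≤s k≤n) = toeplitz-entry t n k k≤n

LowerTri-toeplitz : ∀ t → LowerTri (toeplitz t)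
LowerTri-toeplitz t zero    (suc k) _         = refl
LowerTri-toeplitz t (suc n) (suc k) (s≤s n<k) = LowerTri-toeplitz t n k n<k

toeplitz-·-riordan : ∀ t d h → toeplitz t · riordan d h ≋ riordan (t ⊛ d) h
toeplitz-·-riordan t d h n k = begin
  sumTo n (λ j → toeplitz t n j * column j)
    ≡⟨ sumTo-cong n (λ j j≤n → trans (cong (_* column j) (toeplitz-entry t n j j≤n)) (ZP.*-comm (t (n ∸ j)) (column j))) ⟩
  (column ⊛ t) n              ≡⟨ ⊛-comm column t n ⟩
  (t ⊛ (d ⊛ powS h k)) n      ≡⟨ ⊛-assoc t d (powS h k) n ⟨
  riordan (t ⊛ d) h n k       ∎
  where
  open ≡-Reasoning
  column : Series
  column = d ⊛ powS h k

riordan-cong : ∀ {d d'} h → d ≗ d' → riordan d h ≋ riordan d' h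
riordan-cong h d≗d' n k = ⊛-congʳ (powS h k) d≗d' n

riordan-X⊛ : ∀ d E {h} → h ≗ X ⊛ E → ∀ k → d ⊛ powS h k ≗ powS X k ⊛ (d ⊛ powS E k)
riordan-X⊛ d E h≗XE k n = trans (⊛-congˡ d (λ i → trans (powS-cong k h≗XE i) (powS-⊛ X E k i)) n)
                                 (⊛-leftComm d (powS X k) (powS E k) n)

riordan-column : ∀ d E {h} → h ≗ X ⊛ E → ∀ k m → riordan d h (k +ℕ m) k ≡ (d ⊛ powS E k) m
riordan-column d E h≗XE k m = trans (riordan-X⊛ d E h≗XE k (k +ℕ m)) (powS-X-shift k m (d ⊛ powS E k))

riordan-lower : ∀ d E {h} → h ≗ X ⊛ E → LowerTri (riordan d h)
riordan-lower d E h≗XE n k n<k = trans (riordan-X⊛ d E h≗XE k n) (powS-X-below k n (d ⊛ powS E k) n<k)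

riordan-unitriangular : ∀ {d E h} → d 0 ≡ + 1 → E 0 ≡ + 1 → h ≗ X ⊛ E → Unitriangular (riordan d h)
riordan-unitriangular {d} {E} {h} d0≡1 E0≡1 h≗XE = riordan-lower d E h≗XE , diagonal
  where
  diagonal : ∀ n → riordan d h n n ≡ + 1
  diagonal n = begin
    riordan d h n n             ≡⟨ cong (λ i → riordan d h i n) (NP.+-identityʳ n) ⟨
    riordan d h (n +ℕ 0) n      ≡⟨ riordan-column d E h≗XE n 0 ⟩
    d 0 * powS E n 0            ≡⟨ cong₂ _*_ d0≡1 (powS-head E n E0≡1) ⟩
    + 1                         ∎
    where open ≡-Reasoning

≋-by-columns : ∀ {A B} → LowerTri A → LowerTri B → (∀ k m → A (k +ℕ m) k ≡ B (k +ℕ m) k) → A ≋ B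
≋-by-columns {A} {B} lowA lowB columns n k with k NP.≤? n
... | yes k≤n = subst (λ i → A i k ≡ B i k) (NP.m+[n∸m]≡n k≤n) (columns k (n ∸ k))
... | no  k≰n = trans (lowA n k (NP.≰⇒> k≰n)) (sym (lowB n k (NP.≰⇒> k≰n)))

-- Lagrange inversion

module LagrangeInversion (g f φ : Series) (g0≡1 : g 0 ≡ + 1) (f0≡1 : f 0 ≡ + 1)
                         (reversion : IsReversionOf φ (X ⊛ invS f)) where

  open Composition φ (proj₁ reversion)

  F G : Series
  F = f ∘ₛ φ
  G = g ∘ₛ φ

  F0≡1 : F 0 ≡ + 1
  F0≡1 = trans (ZP.*-identityʳ (f 0)) f0≡1

  G0≡1 : G 0 ≡ + 1
  G0≡1 = trans (ZP.*-identityʳ (g 0)) g0≡1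

  φ≗X⊛F : φ ≗ X ⊛ F
  φ≗X⊛F = begin
    φ                   ≈⟨ ⊛-identityʳ φ ⟨
    φ ⊛ oneS            ≈⟨ ⊛-congˡ φ I⊛F≗1 ⟨
    φ ⊛ (I ⊛ F)         ≈⟨ ⊛-assoc φ I F ⟨
    φ ⊛ I ⊛ F           ≈⟨ ⊛-congʳ F φ⊛I≗X ⟩
    X ⊛ F               ∎
    where
    open ≗-Reasoning
    I : Series
    I = invS f ∘ₛ φ
    φ⊛I≗X : φ ⊛ I ≗ X
    φ⊛I≗X n = trans (sym (⊛-congʳ I ∘ₛ-X n)) (trans (sym (∘ₛ-⊛ X (invS f) n)) (proj₂ reversion n))
    I⊛F≗1 : I ⊛ F ≗ oneS
    I⊛F≗1 n = trans (sym (∘ₛ-⊛ (invS f) f n))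
      (trans (∘ₛ-cong (λ i → trans (⊛-comm (invS f) f i) (invS-inverseʳ f f0≡1 i)) n) (∘ₛ-oneS n))

  -- By deriv-φ, this is φ' / f(φ).
  diagPow : Series
  diagPow n = powS f n n

  -- Induction on n generalising H: a factor f on the left matches φ = x f(φ) on the right.
  lagrange : ∀ n H → (H ⊛ powS f n) n ≡ (diagPow ⊛ H ∘ₛ φ) n
  lagrange zero    H = trans (ZP.*-identityʳ (H 0)) (sym (trans (ZP.*-identityˡ _) (ZP.*-identityʳ (H 0))))
  lagrange (suc n) H = begin
    (H ⊛ powS f (suc n)) (suc n)
      ≡⟨ ⊛-suc H (powS f (suc n)) n ⟩
    H 0 * diagPow (suc n) + (tailS H ⊛ (f ⊛ powS f n)) n
      ≡⟨ cong (λ x → H 0 * diagPow (suc n) + x) (trans (sym (⊛-assoc (tailS H) f (powS f n) n)) (lagrange n (tailS H ⊛ f))) ⟩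
    H 0 * diagPow (suc n) + (diagPow ⊛ (tailS H ⊛ f) ∘ₛ φ) n
      ≡⟨ cong₂ _+_ (cong (H 0 *_) (sym (⊛-identityʳ diagPow (suc n)))) (sym shifted) ⟩
    H 0 * (diagPow ⊛ oneS) (suc n) + (diagPow ⊛ (φ ⊛ H')) (suc n)
      ≡⟨ cong (_+ (diagPow ⊛ (φ ⊛ H')) (suc n)) (sym (⊛-• (H 0) diagPow oneS (suc n))) ⟩
    (diagPow ⊛ H 0 • oneS) (suc n) + (diagPow ⊛ (φ ⊛ H')) (suc n)
      ≡⟨ ⊛-distribˡ diagPow (H 0 • oneS) (φ ⊛ H') (suc n) ⟨
    (diagPow ⊛ (H 0 • oneS ⊕ φ ⊛ H')) (suc n)
      ≡⟨ ⊛-congˡ diagPow (∘ₛ-head-tail H) (suc n) ⟨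
    (diagPow ⊛ H ∘ₛ φ) (suc n)
      ∎
    where
    open ≡-Reasoning
    H' : Series
    H' = tailS H ∘ₛ φ
    shifted : (diagPow ⊛ (φ ⊛ H')) (suc n) ≡ (diagPow ⊛ (tailS H ⊛ f) ∘ₛ φ) n
    shifted = begin
      (diagPow ⊛ (φ ⊛ H')) (suc n)       ≡⟨ ⊛-congˡ diagPow (λ i → trans (⊛-congʳ H' φ≗X⊛F i) (⊛-assoc X F H' i)) (suc n) ⟩
      (diagPow ⊛ (X ⊛ (F ⊛ H'))) (suc n) ≡⟨ ⊛-leftComm diagPow X (F ⊛ H') (suc n) ⟩
      (X ⊛ (diagPow ⊛ (F ⊛ H'))) (suc n) ≡⟨ X⊛-suc (diagPow ⊛ (F ⊛ H')) n ⟩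
      (diagPow ⊛ (F ⊛ H')) n             ≡⟨ ⊛-congˡ diagPow (λ i → trans (sym (∘ₛ-⊛ f (tailS H) i))
                                                                       (∘ₛ-cong (⊛-comm f (tailS H)) i)) n ⟩
      (diagPow ⊛ (tailS H ⊛ f) ∘ₛ φ) n   ∎

  -- (n+1) c_{n+1} = [x^n] (f^{n+1})' = (n+1) [x^n] f' f^n, and Lagrange applies to the last coefficient.
  diagPow-rec : diagPow ≗ oneS ⊕ X ⊛ (diagPow ⊛ deriv f ∘ₛ φ)
  diagPow-rec zero    = refl
  diagPow-rec (suc n) = trans (ZP.*-cancelˡ-≡ (+ suc n) (diagPow (suc n)) ((diagPow ⊛ deriv f ∘ₛ φ) n) scaled)
                              (sym (trans (ZP.+-identityˡ _) (X⊛-suc (diagPow ⊛ deriv f ∘ₛ φ) n)))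
    where
    scaled : + suc n * diagPow (suc n) ≡ + suc n * (diagPow ⊛ deriv f ∘ₛ φ) n
    scaled = trans (deriv-powS f n n)
                   (cong (+ suc n *_) (trans (⊛-comm (powS f n) (deriv f) n) (lagrange n (deriv f))))

  -- Both sides solve y = F + x f'(φ) y: the left by the chain rule applied to φ = x F.
  deriv-φ : deriv φ ≗ F ⊛ diagPow
  deriv-φ = fixpoint-unique F (X ⊛ f'φ) refl deriv-φ-fix F⊛diagPow-fix
    where
    f'φ : Series
    f'φ = deriv f ∘ₛ φ
    deriv-φ-fix : deriv φ ≗ F ⊕ X ⊛ f'φ ⊛ deriv φ
    deriv-φ-fix n = trans (deriv-cong φ≗X⊛F n) (trans (deriv-X⊛ F n)
      (cong (λ x → F n + x) (trans (⊛-congˡ X (deriv-∘ₛ f) n) (sym (⊛-assoc X f'φ (deriv φ) n)))))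
    F⊛diagPow-fix : F ⊛ diagPow ≗ F ⊕ X ⊛ f'φ ⊛ (F ⊛ diagPow)
    F⊛diagPow-fix = begin
      F ⊛ diagPow                              ≈⟨ ⊛-congˡ F diagPow-rec ⟩
      F ⊛ (oneS ⊕ X ⊛ (diagPow ⊛ f'φ))         ≈⟨ ⊛-distribˡ F oneS (X ⊛ (diagPow ⊛ f'φ)) ⟩
      F ⊛ oneS ⊕ F ⊛ (X ⊛ (diagPow ⊛ f'φ))     ≈⟨ ⊕-cong (⊛-identityʳ F) rearrange ⟩
      F ⊕ X ⊛ f'φ ⊛ (F ⊛ diagPow)              ∎
      where
      open ≗-Reasoning
      rearrange : F ⊛ (X ⊛ (diagPow ⊛ f'φ)) ≗ X ⊛ f'φ ⊛ (F ⊛ diagPow)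
      rearrange = begin
        F ⊛ (X ⊛ (diagPow ⊛ f'φ))  ≈⟨ ⊛-leftComm F X (diagPow ⊛ f'φ) ⟩
        X ⊛ (F ⊛ (diagPow ⊛ f'φ))  ≈⟨ ⊛-congˡ X (λ i → trans (sym (⊛-assoc F diagPow f'φ i)) (⊛-comm (F ⊛ diagPow) f'φ i)) ⟩
        X ⊛ (f'φ ⊛ (F ⊛ diagPow))  ≈⟨ ⊛-assoc X f'φ (F ⊛ diagPow) ⟨
        X ⊛ f'φ ⊛ (F ⊛ diagPow)    ∎

  h : Series
  h = hRHS f φ

  h≗X⊛F⊛F : h ≗ X ⊛ (F ⊛ F)
  h≗X⊛F⊛F n = trans (⊛-congʳ F φ≗X⊛F n) (⊛-assoc X F F n)

  powS-F⊛F : ∀ k → powS (F ⊛ F) k ≗ powS F (k +ℕ k)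
  powS-F⊛F k n = trans (powS-⊛ F F k n) (sym (powS-+ F k k n))

  d₁ : Series
  d₁ = diagPow ⊛ G

  aEntry-column : ∀ p m → aEntry g f ((p +ℕ m) +ℕ m) (p +ℕ m) ≡ (diagPow ⊛ (G ⊛ powS F p)) m
  aEntry-column p m = begin
    aEntry g f ((p +ℕ m) +ℕ m) (p +ℕ m)     ≡⟨ riordan-column g f (λ _ → refl) (p +ℕ m) m ⟩
    (g ⊛ powS f (p +ℕ m)) m                ≡⟨ ⊛-congˡ g (powS-+ f p m) m ⟩
    (g ⊛ (powS f p ⊛ powS f m)) m          ≡⟨ ⊛-assoc g (powS f p) (powS f m) m ⟨
    (g ⊛ powS f p ⊛ powS f m) m            ≡⟨ lagrange m (g ⊛ powS f p) ⟩
    (diagPow ⊛ (g ⊛ powS f p) ∘ₛ φ) m      ≡⟨ ⊛-congˡ diagPow (λ i → trans (∘ₛ-⊛ g (powS f p) i) (⊛-congˡ G (∘ₛ-powS f p) i)) m ⟩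
    (diagPow ⊛ (G ⊛ powS F p)) m           ∎
    where open ≡-Reasoning

  cA1≋riordan : cA1 g f ≋ riordan d₁ h
  cA1≋riordan = ≋-by-columns lower (riordan-lower d₁ (F ⊛ F) h≗X⊛F⊛F) column
    where
    lower : LowerTri (cA1 g f)
    lower n k n<k = riordan-lower g f (λ _ → refl) (n +ℕ n) (n +ℕ k) (NP.+-monoʳ-< n n<k)
    column : ∀ k m → cA1 g f (k +ℕ m) k ≡ riordan d₁ h (k +ℕ m) k
    column k m = begin
      aEntry g f ((k +ℕ m) +ℕ (k +ℕ m)) ((k +ℕ m) +ℕ k) ≡⟨ cong₂ (aEntry g f) (row k m) (col k m) ⟩
      aEntry g f (((k +ℕ k) +ℕ m) +ℕ m) ((k +ℕ k) +ℕ m) ≡⟨ aEntry-column (k +ℕ k) m ⟩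
      (diagPow ⊛ (G ⊛ powS F (k +ℕ k))) m               ≡⟨ ⊛-assoc diagPow G (powS F (k +ℕ k)) m ⟨
      (d₁ ⊛ powS F (k +ℕ k)) m                          ≡⟨ ⊛-congˡ d₁ (powS-F⊛F k) m ⟨
      (d₁ ⊛ powS (F ⊛ F) k) m                           ≡⟨ riordan-column d₁ (F ⊛ F) h≗X⊛F⊛F k m ⟨
      riordan d₁ h (k +ℕ m) k                           ∎
      where
      open ≡-Reasoning
      row : ∀ k m → (k +ℕ m) +ℕ (k +ℕ m) ≡ ((k +ℕ k) +ℕ m) +ℕ m
      row = ℕSolver.solve-∀
      col : ∀ k m → (k +ℕ m) +ℕ k ≡ (k +ℕ k) +ℕ m
      col = ℕSolver.solve-∀

  cA2≋riordan : cA2 g f ≋ riordan (F ⊛ d₁) h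
  cA2≋riordan = ≋-by-columns lower (riordan-lower (F ⊛ d₁) (F ⊛ F) h≗X⊛F⊛F) column
    where
    lower : LowerTri (cA2 g f)
    lower n k n<k = riordan-lower g f (λ _ → refl) (suc (n +ℕ n)) (suc (n +ℕ k)) (s≤s (NP.+-monoʳ-< n n<k))
    rearrange : ∀ P → diagPow ⊛ (G ⊛ (F ⊛ P)) ≗ F ⊛ d₁ ⊛ P
    rearrange P = begin
      diagPow ⊛ (G ⊛ (F ⊛ P))   ≈⟨ ⊛-congˡ diagPow (⊛-leftComm G F P) ⟩
      diagPow ⊛ (F ⊛ (G ⊛ P))   ≈⟨ ⊛-leftComm diagPow F (G ⊛ P) ⟩
      F ⊛ (diagPow ⊛ (G ⊛ P))   ≈⟨ ⊛-congˡ F (λ i → sym (⊛-assoc diagPow G P i)) ⟩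
      F ⊛ (d₁ ⊛ P)              ≈⟨ ⊛-assoc F d₁ P ⟨
      F ⊛ d₁ ⊛ P                ∎
      where open ≗-Reasoning
    column : ∀ k m → cA2 g f (k +ℕ m) k ≡ riordan (F ⊛ d₁) h (k +ℕ m) k
    column k m = begin
      aEntry g f (suc ((k +ℕ m) +ℕ (k +ℕ m))) (suc ((k +ℕ m) +ℕ k))
        ≡⟨ cong₂ (aEntry g f) (row k m) (col k m) ⟩
      aEntry g f ((suc (k +ℕ k) +ℕ m) +ℕ m) (suc (k +ℕ k) +ℕ m)
        ≡⟨ aEntry-column (suc (k +ℕ k)) m ⟩
      (diagPow ⊛ (G ⊛ (F ⊛ P))) m   ≡⟨ rearrange P m ⟩
      (F ⊛ d₁ ⊛ P) m                ≡⟨ ⊛-congˡ (F ⊛ d₁) (powS-F⊛F k) m ⟨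
      (F ⊛ d₁ ⊛ powS (F ⊛ F) k) m   ≡⟨ riordan-column (F ⊛ d₁) (F ⊛ F) h≗X⊛F⊛F k m ⟨
      riordan (F ⊛ d₁) h (k +ℕ m) k ∎
      where
      open ≡-Reasoning
      P : Series
      P = powS F (k +ℕ k)
      row : ∀ k m → suc ((k +ℕ m) +ℕ (k +ℕ m)) ≡ (suc (k +ℕ k) +ℕ m) +ℕ m
      row = ℕSolver.solve-∀
      col : ∀ k m → suc ((k +ℕ m) +ℕ k) ≡ suc (k +ℕ k) +ℕ m
      col = ℕSolver.solve-∀

  dR : Series
  dR = dRHS g f φ

  F⊛dR≗d₁ : F ⊛ dR ≗ d₁
  F⊛dR≗d₁ = begin
    F ⊛ (deriv φ ⊛ G ⊛ I)          ≈⟨ ⊛-congˡ F (⊛-congʳ I (⊛-congʳ G deriv-φ)) ⟩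
    F ⊛ (F ⊛ diagPow ⊛ G ⊛ I)      ≈⟨ ⊛-congˡ F (⊛-congʳ I (⊛-assoc F diagPow G)) ⟩
    F ⊛ (F ⊛ d₁ ⊛ I)               ≈⟨ ⊛-congˡ F (⊛-assoc F d₁ I) ⟩
    F ⊛ (F ⊛ (d₁ ⊛ I))             ≈⟨ ⊛-assoc F F (d₁ ⊛ I) ⟨
    F ⊛ F ⊛ (d₁ ⊛ I)               ≈⟨ ⊛-leftComm (F ⊛ F) d₁ I ⟩
    d₁ ⊛ (F ⊛ F ⊛ I)               ≈⟨ ⊛-congˡ d₁ (invS-inverseʳ (F ⊛ F) F⊛F0≡1) ⟩
    d₁ ⊛ oneS                      ≈⟨ ⊛-identityʳ d₁ ⟩
    d₁                             ∎
    where
    open ≗-Reasoning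
    I : Series
    I = invS (F ⊛ F)
    F⊛F0≡1 : (F ⊛ F) 0 ≡ + 1
    F⊛F0≡1 = cong₂ _*_ F0≡1 F0≡1

  d₁0≡1 : d₁ 0 ≡ + 1
  d₁0≡1 = trans (ZP.*-identityˡ (G 0)) G0≡1

  T R : Matrix
  T = toeplitz F
  R = riordan dR h

  cA1-unitriangular : Unitriangular (cA1 g f)
  cA1-unitriangular = (λ n k n<k → trans (cA1≋riordan n k) (proj₁ unitriangular n k n<k))
                    , (λ n → trans (cA1≋riordan n n) (proj₂ unitriangular n))
    where
    unitriangular : Unitriangular (riordan d₁ h)
    unitriangular = riordan-unitriangular {d₁} {F ⊛ F} d₁0≡1 (cong₂ _*_ F0≡1 F0≡1) h≗X⊛F⊛F

  R-unitriangular : Unitriangular R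
  R-unitriangular = riordan-unitriangular {dR} {F ⊛ F} dR0≡1 (cong₂ _*_ F0≡1 F0≡1) h≗X⊛F⊛F
    where
    dR0≡1 : dR 0 ≡ + 1
    dR0≡1 = trans (sym (ZP.*-identityˡ (dR 0))) (trans (cong (_* dR 0) (sym F0≡1)) (trans (F⊛dR≗d₁ 0) d₁0≡1))

  cA1≋T·R : cA1 g f ≋ T · R
  cA1≋T·R n k = trans (cA1≋riordan n k)
    (trans (riordan-cong h (λ i → sym (F⊛dR≗d₁ i)) n k) (sym (toeplitz-·-riordan F dR h n k)))

  cA2≋T·cA1 : cA2 g f ≋ T · cA1 g f
  cA2≋T·cA1 n k = trans (cA2≋riordan n k)
    (trans (sym (toeplitz-·-riordan F d₁ h n k)) (·-congˡ T (λ i j → sym (cA1≋riordan i j)) n k))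

mainTheorem11 : (g f φ : Series) → g 0 ≡ + 1 → f 0 ≡ + 1 →
    IsReversionOf φ (X ⊛ invS f) →
    (M : Matrix) → LowerTri M → (∀ n k → (M · cA1 g f) n k ≡ δ n k) →
    (N : Matrix) → LowerTri N → (∀ n k → (N · riordan (dRHS g f φ) (hRHS f φ)) n k ≡ δ n k) →
    ∀ n k → (M · cA2 g f · M) n k ≡ N n k
mainTheorem11 g f φ g0≡1 f0≡1 reversion M lowM MA≋δ N lowN NR≋δ n k = begin
  (M · cA2 g f · M) n k         ≡⟨ ·-congʳ M (·-congˡ M cA2≋T·cA1) n k ⟩
  (M · (T · cA1 g f) · M) n k   ≡⟨ left-inverse-sandwich cA1-unitriangular R-unitriangular (LowerTri-toeplitz F)
                                                         lowM lowN cA1≋T·R MA≋δ NR≋δ n k ⟩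
  N n k                         ∎
  where
  open ≡-Reasoning
  open LagrangeInversion g f φ g0≡1 f0≡1 reversion
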